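{- Let $(G,R)$ be a rooted graph and let $e=uv$ with $u,v\in V(G)$. If $(G+e,R)$ contains a rooted $K_{2,t}$-model for some $t\ge 2$, then $(G,R)$ contains a rooted $K_{2,\lceil t/2\rceil}$-model.
   Context: A rooted graph $(G,R)$ is a graph with a set $R\subseteq V(G)$ of roots. A rooted $K_{2,t}$-model in $(G,R)$ is a family of pairwise disjoint vertex sets (branch sets), one for each vertex of $K_{2,t}$, each inducing a connected subgraph of $G$, with an edge of $G$ between the branch sets of any two adjacent vertices of $K_{2,t}$, such that each of the $t$ branch sets corresponding to vertices of the larger side of $K_{2,t}$ contains a root. -}

module Defs where

open import Data.Nat using (ℕ)
open import Data.Fin using (Fin)
open import Data.Product using (Σ; ∃; _×_; _,_)
open import Data.Sum using (_⊎_)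
open import Data.Empty using (⊥)
open import Relation.Nullary using (¬_)
open import Relation.Binary.PropositionalEquality using (_≡_)

record Graph (n : ℕ) : Set₁ where
  field
    Adj : Fin n → Fin n → Set
    sym : ∀ {x y} → Adj x y → Adj y x
open Graph public

VSet : ℕ → Set₁
VSet n = Fin n → Set

_+E_ : ∀ {n} → Graph n → Fin n × Fin n → Graph n
Adj (G +E (u , v)) x y = Adj G x y ⊎ ((x ≡ u × y ≡ v) ⊎ (x ≡ v × y ≡ u))
sym (G +E (u , v)) (Data.Sum.inj₁ a) = Data.Sum.inj₁ (sym G a)
sym (G +E (u , v)) (Data.Sum.inj₂ (Data.Sum.inj₁ (p , q))) = Data.Sum.inj₂ (Data.Sum.inj₂ (q , p))
sym (G +E (u , v)) (Data.Sum.inj₂ (Data.Sum.inj₂ (p , q))) = Data.Sum.inj₂ (Data.Sum.inj₁ (q , p))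

data WalkIn {n} (G : Graph n) (B : VSet n) : Fin n → Fin n → Set where
  here : ∀ {x} → B x → WalkIn G B x x
  step : ∀ {x y z} → B x → Adj G x y → WalkIn G B y z → WalkIn G B x z

Connected : ∀ {n} → Graph n → VSet n → Set
Connected G B = (∃ λ x → B x) × (∀ x y → B x → B y → WalkIn G B x y)

Disjoint : ∀ {n} → VSet n → VSet n → Set
Disjoint A B = ∀ x → A x → B x → ⊥

EdgeBetween : ∀ {n} → Graph n → VSet n → VSet n → Set
EdgeBetween G A B = ∃ λ x → ∃ λ y → A x × B y × Adj G x y

record RootedK2Model {n} (G : Graph n) (R : VSet n) (t : ℕ) : Set₁ where
  field
    A₁ A₂ : VSet n
    Bs : Fin t → VSet n
    conn-A₁ : Connected G A₁
    conn-A₂ : Connected G A₂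
    conn-B : ∀ j → Connected G (Bs j)
    disj-A₁A₂ : Disjoint A₁ A₂
    disj-A₁B : ∀ j → Disjoint A₁ (Bs j)
    disj-A₂B : ∀ j → Disjoint A₂ (Bs j)
    disj-BB : ∀ j k → ¬ (j ≡ k) → Disjoint (Bs j) (Bs k)
    edge-A₁B : ∀ j → EdgeBetween G A₁ (Bs j)
    edge-A₂B : ∀ j → EdgeBetween G A₂ (Bs j)
    root-B : ∀ j → ∃ λ r → Bs j r × R r

-- Replace each branch set by the component, in G, of one of its vertices.  If both ends
-- of uv lie in A₁, every B_j stays attached to the component of u or to that of v, and one
-- of the two serves at least ⌈t/2⌉ of them (symmetrically for A₂).  Otherwise the edges
-- leaving A₁ and A₂ are still reached inside G, and B_j can lose its attachment only if
-- it contains an end of uv whose other end lies in A₁ ∪ A₂ ∪ B_j; by disjointness this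
-- happens for at most one j, and t − 1 ≥ ⌈t/2⌉.
module Submission where

open import Defs
open import Data.Nat using (ℕ; zero; suc; _+_; _≤_; _≥_; z≤n; s≤s; ⌈_/2⌉)
open import Data.Nat.Properties
  using (≤-trans; ≤-pred; ≤-reflexive; +-suc; +-comm; +-identityʳ; +-monoʳ-≤; ⌈n/2⌉≤n; ⌈n/2⌉<n)
open import Data.Fin using (Fin; zero; suc; _≟_)
open import Data.Fin.Properties using (suc-injective; 0≢1+n)
open import Data.Product using (Σ; ∃₂; _×_; _,_; proj₁; proj₂)
open import Data.Sum using (_⊎_; inj₁; inj₂; [_,_]′; swap)
import Data.Sum as Sum
open import Data.Empty using (⊥; ⊥-elim)
open import Relation.Nullary using (¬_; yes; no)
open import Relation.Binary.PropositionalEquality using (_≡_; refl; cong; subst) renaming (sym to ≡-sym)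
open import Function using (_∘_; id; const)
open import Function.Definitions using (Injective)

⌈n/2⌉≤m⊎⌈n/2⌉≤o : ∀ n m o → n ≤ m + o → ⌈ n /2⌉ ≤ m ⊎ ⌈ n /2⌉ ≤ o
⌈n/2⌉≤m⊎⌈n/2⌉≤o n             zero    o       n≤o = inj₂ (≤-trans (⌈n/2⌉≤n n) n≤o)
⌈n/2⌉≤m⊎⌈n/2⌉≤o zero          (suc m) o       _   = inj₁ z≤n
⌈n/2⌉≤m⊎⌈n/2⌉≤o (suc zero)    (suc m) o       _   = inj₁ (s≤s z≤n)
⌈n/2⌉≤m⊎⌈n/2⌉≤o (suc (suc n)) (suc m) zero    le  =
  inj₁ (≤-trans (⌈n/2⌉≤n (suc (suc n))) (≤-trans le (≤-reflexive (+-identityʳ (suc m)))))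
⌈n/2⌉≤m⊎⌈n/2⌉≤o (suc (suc n)) (suc m) (suc o) (s≤s le) =
  Sum.map s≤s s≤s (⌈n/2⌉≤m⊎⌈n/2⌉≤o n m o (≤-pred (≤-trans le (≤-reflexive (+-suc m o)))))

⊎-∀ : ∀ {t} {P : Set} {Q : Fin t → Set} → (∀ j → P ⊎ Q j) → P ⊎ (∀ j → Q j)
⊎-∀ {zero}  h = inj₂ λ ()
⊎-∀ {suc t} h with h zero | ⊎-∀ (h ∘ suc)
... | inj₁ p | _       = inj₁ p
... | inj₂ _ | inj₁ p  = inj₁ p
... | inj₂ q | inj₂ qs = inj₂ λ { zero → q ; (suc j) → qs j }

Selection : ∀ {t} → (Fin t → Set) → ℕ → Set
Selection {t} P m = Σ (Fin m → Fin t) λ f → Injective _≡_ _≡_ f × (∀ i → P (f i))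

countˡ : ∀ {t} {P Q : Fin t → Set} → (∀ j → P j ⊎ Q j) → ℕ
countˡ {zero}  h = 0
countˡ {suc t} h = [ const 1 , const 0 ]′ (h zero) + countˡ (h ∘ suc)

countˡ+countʳ : ∀ {t} {P Q : Fin t → Set} (h : ∀ j → P j ⊎ Q j) →
                countˡ h + countˡ (swap ∘ h) ≡ t
countˡ+countʳ {zero}  h = refl
countˡ+countʳ {suc t} h with h zero
... | inj₁ _ = cong suc (countˡ+countʳ (h ∘ suc))
... | inj₂ _ = subst (_≡ suc t) (≡-sym (+-suc (countˡ (h ∘ suc)) _))
                     (cong suc (countˡ+countʳ (h ∘ suc)))

countˡ≡0 : ∀ {t} {P Q : Fin t → Set} (h : ∀ j → P j ⊎ Q j) → (∀ j → ¬ P j) → countˡ h ≡ 0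
countˡ≡0 {zero}  h ¬P = refl
countˡ≡0 {suc t} h ¬P with h zero
... | inj₁ p = ⊥-elim (¬P zero p)
... | inj₂ _ = countˡ≡0 (h ∘ suc) (¬P ∘ suc)

countˡ≤1 : ∀ {t} {P Q : Fin t → Set} (h : ∀ j → P j ⊎ Q j) →
           (∀ {j k} → P j → P k → j ≡ k) → countˡ h ≤ 1
countˡ≤1 {zero}  h unique = z≤n
countˡ≤1 {suc t} h unique with h zero
... | inj₁ p = s≤s (≤-reflexive (countˡ≡0 (h ∘ suc) λ j q → 0≢1+n (unique p q)))
... | inj₂ _ = countˡ≤1 (h ∘ suc) (λ p q → suc-injective (unique p q))

Selection-skip : ∀ {t m} {P : Fin (suc t) → Set} → Selection (P ∘ suc) m → Selection P m
Selection-skip (g , g-inj , Pg) = suc ∘ g , g-inj ∘ suc-injective , Pg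

Selection-cons : ∀ {t m} {P : Fin (suc t) → Set} → P zero → Selection (P ∘ suc) m → Selection P (suc m)
Selection-cons {t} {m} {P} p (g , g-inj , Pg) = f , f-inj , Pf
  where
  f : Fin (suc m) → Fin (suc t)
  f zero    = zero
  f (suc i) = suc (g i)

  f-inj : Injective _≡_ _≡_ f
  f-inj {zero}  {zero}  _ = refl
  f-inj {suc i} {suc k} e = cong suc (g-inj (suc-injective e))
  f-inj {zero}  {suc k} ()
  f-inj {suc i} {zero}  ()

  Pf : ∀ i → P (f i)
  Pf zero    = p
  Pf (suc i) = Pg i

select : ∀ {t} {P Q : Fin t → Set} (h : ∀ j → P j ⊎ Q j) m → m ≤ countˡ h → Selection P m
select h zero _ = (λ ()) , (λ { {()} }) , (λ ())
select {zero} h (suc m) ()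
select {suc t} {P} h (suc m) le with h zero
... | inj₁ p = Selection-cons {P = P} p (select (h ∘ suc) m (≤-pred le))
... | inj₂ _ = Selection-skip {P = P} (select (h ∘ suc) (suc m) le)

select-half : ∀ {t} {P Q : Fin t → Set} → (∀ j → P j ⊎ Q j) →
              Selection P ⌈ t /2⌉ ⊎ Selection Q ⌈ t /2⌉
select-half {t} h =
  Sum.map (select h _) (select (swap ∘ h) _)
          (⌈n/2⌉≤m⊎⌈n/2⌉≤o t _ _ (≤-reflexive (≡-sym (countˡ+countʳ h))))

select-all-but-one : ∀ {t} {P Q : Fin t → Set} (h : ∀ j → P j ⊎ Q j) →
                     (∀ {j k} → Q j → Q k → j ≡ k) → t ≥ 2 → Selection P ⌈ t /2⌉
select-all-but-one {suc (suc t)} h unique (s≤s (s≤s _)) = select h _ (≤-pred ⌈t/2⌉<1+count)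
  where
  ⌈t/2⌉<1+count : suc ⌈ suc (suc t) /2⌉ ≤ suc (countˡ h)
  ⌈t/2⌉<1+count =
    ≤-trans (⌈n/2⌉<n t)
   (≤-trans (≤-reflexive (≡-sym (countˡ+countʳ h)))
   (≤-trans (+-monoʳ-≤ (countˡ h) (countˡ≤1 (swap ∘ h) unique))
            (≤-reflexive (+-comm (countˡ h) 1))))

module _ {n} {H : Graph n} {S : VSet n} where

  walk-start : ∀ {x y} → WalkIn H S x y → S x
  walk-start (here s)     = s
  walk-start (step s _ _) = s

  walk-end : ∀ {x y} → WalkIn H S x y → S y
  walk-end (here s)     = s
  walk-end (step _ _ w) = walk-end w

  _++_ : ∀ {x y z} → WalkIn H S x y → WalkIn H S y z → WalkIn H S x z
  here _     ++ w′ = w′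
  step s a w ++ w′ = step s a (w ++ w′)

  reverse : ∀ {x y} → WalkIn H S x y → WalkIn H S y x
  reverse (here s)     = here s
  reverse (step s a w) = reverse w ++ step (walk-start w) (sym H a) (here s)

  walk-in-component : ∀ {c x y} → WalkIn H S c x → WalkIn H S x y → WalkIn H (WalkIn H S c) x y
  walk-in-component p (here _)     = here p
  walk-in-component p (step _ a w) =
    step p a (walk-in-component (p ++ step (walk-end p) a (here (walk-start w))) w)

component-connected : ∀ {n} (H : Graph n) (S : VSet n) {c} → S c → Connected H (WalkIn H S c)
component-connected H S {c} s =
  (c , here s) , λ x y p q → walk-in-component p (reverse p ++ q)

module AddEdge {n} (G : Graph n) (u v : Fin n) where

  walk-+E : ∀ {S : VSet n} {a x} → WalkIn (G +E (u , v)) S a x →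
            WalkIn G S a x ⊎ (S u × S v × (WalkIn G S u x ⊎ WalkIn G S v x))
  walk-+E (here s) = inj₁ (here s)
  walk-+E (step s a w) with walk-+E w | a
  ... | inj₂ tail | _                         = inj₂ tail
  ... | inj₁ w′   | inj₁ g                    = inj₁ (step s g w′)
  ... | inj₁ w′   | inj₂ (inj₁ (refl , refl)) = inj₂ (s , walk-start w′ , inj₂ w′)
  ... | inj₁ w′   | inj₂ (inj₂ (refl , refl)) = inj₂ (walk-start w′ , s , inj₁ w′)

  walk-+E-avoiding : ∀ {S : VSet n} {a x} → ¬ S u → WalkIn (G +E (u , v)) S a x → WalkIn G S a x
  walk-+E-avoiding ¬Su w = [ id , (λ (Su , _) → ⊥-elim (¬Su Su)) ]′ (walk-+E w)

  walk-+E-from-end : ∀ {S : VSet n} {x} → WalkIn (G +E (u , v)) S u x → WalkIn G S u x ⊎ WalkIn G S v x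
  walk-+E-from-end w = [ inj₁ , (λ (_ , _ , w′) → w′) ]′ (walk-+E w)

  adj-+E-avoiding : ∀ (S : VSet n) {x y} → ¬ S u → ¬ S v → S y → Adj (G +E (u , v)) x y → Adj G x y
  adj-+E-avoiding S ¬Su ¬Sv Sy (inj₁ g)                    = g
  adj-+E-avoiding S ¬Su ¬Sv Sy (inj₂ (inj₁ (refl , refl))) = ⊥-elim (¬Sv Sy)
  adj-+E-avoiding S ¬Su ¬Sv Sy (inj₂ (inj₂ (refl , refl))) = ⊥-elim (¬Su Sy)

swapSides : ∀ {n} {H : Graph n} {R : VSet n} {t} → RootedK2Model H R t → RootedK2Model H R t
swapSides M = record
  { A₁ = A₂ ; A₂ = A₁ ; Bs = Bs ; conn-A₁ = conn-A₂ ; conn-A₂ = conn-A₁ ; conn-B = conn-B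
  ; disj-A₁A₂ = λ x p q → disj-A₁A₂ x q p ; disj-A₁B = disj-A₂B ; disj-A₂B = disj-A₁B
  ; disj-BB = disj-BB ; edge-A₁B = edge-A₂B ; edge-A₂B = edge-A₁B ; root-B = root-B }
  where open RootedK2Model M

module Restriction {n} (G : Graph n) {H : Graph n} {R : VSet n} {t}
                   (M : RootedK2Model H R t) where
  open RootedK2Model M

  root : Fin t → Fin n
  root j = proj₁ (root-B j)

  root∈B : ∀ j → Bs j (root j)
  root∈B j = proj₁ (proj₂ (root-B j))

  Attached : VSet n → Fin n → Fin t → Set
  Attached A c j = ∃₂ λ x y → WalkIn G A c x × WalkIn G (Bs j) (root j) y × Adj G x y

  BothAttached : Fin n → Fin n → Fin t → Set
  BothAttached c₁ c₂ j = Attached A₁ c₁ j × Attached A₂ c₂ j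

  restrict : ∀ {c₁ c₂ m} → A₁ c₁ → A₂ c₂ → Selection (BothAttached c₁ c₂) m → RootedK2Model G R m
  restrict {c₁} {c₂} c₁∈A₁ c₂∈A₂ (f , f-inj , attached) = record
    { A₁ = WalkIn G A₁ c₁
    ; A₂ = WalkIn G A₂ c₂
    ; Bs = λ i → WalkIn G (Bs (f i)) (root (f i))
    ; conn-A₁ = component-connected G A₁ c₁∈A₁
    ; conn-A₂ = component-connected G A₂ c₂∈A₂
    ; conn-B = λ i → component-connected G (Bs (f i)) (root∈B (f i))
    ; disj-A₁A₂ = λ x p q → disj-A₁A₂ x (walk-end p) (walk-end q)
    ; disj-A₁B = λ i x p q → disj-A₁B (f i) x (walk-end p) (walk-end q)
    ; disj-A₂B = λ i x p q → disj-A₂B (f i) x (walk-end p) (walk-end q)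
    ; disj-BB = λ i k i≢k x p q → disj-BB (f i) (f k) (i≢k ∘ f-inj) x (walk-end p) (walk-end q)
    ; edge-A₁B = proj₁ ∘ attached
    ; edge-A₂B = proj₂ ∘ attached
    ; root-B = λ i → root (f i) , here (root∈B (f i)) , proj₂ (proj₂ (root-B (f i)))
    }

module _ {n} {G : Graph n} {R : VSet n} {u v : Fin n} {t}
         (M : RootedK2Model (G +E (u , v)) R t) where
  open RootedK2Model M
  open Restriction G M
  open AddEdge G u v

  a₁ : Fin n
  a₁ = proj₁ (proj₁ conn-A₁)

  a₂ : Fin n
  a₂ = proj₁ (proj₁ conn-A₂)

  a₁∈A₁ : A₁ a₁
  a₁∈A₁ = proj₂ (proj₁ conn-A₁)

  a₂∈A₂ : A₂ a₂
  a₂∈A₂ = proj₂ (proj₁ conn-A₂)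

  walk-from-root : ∀ j {y} → Bs j y → WalkIn (G +E (u , v)) (Bs j) (root j) y
  walk-from-root j = proj₂ (conn-B j) _ _ (root∈B j)

  edge-in-A₁⊎edges-reachable :
    (A₁ u × A₁ v) ⊎ (∀ j → WalkIn G A₁ a₁ (proj₁ (edge-A₁B j)))
  edge-in-A₁⊎edges-reachable = ⊎-∀ λ j →
    [ inj₂ , (λ (u∈A₁ , v∈A₁ , _) → inj₁ (u∈A₁ , v∈A₁)) ]′
      (walk-+E (proj₂ conn-A₁ a₁ _ a₁∈A₁ (proj₁ (proj₂ (proj₂ (edge-A₁B j))))))

  module _ (u∈A₁ : A₁ u) (v∈A₁ : A₁ v) where

    attached-to-an-end : ∀ j → BothAttached u a₂ j ⊎ BothAttached v a₂ j
    attached-to-an-end j = Sum.map (_, attached₂ (edge-A₂B j)) (_, attached₂ (edge-A₂B j))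
                                   (attached₁ (edge-A₁B j))
      where
      u∉B : ¬ Bs j u
      u∉B = disj-A₁B j u u∈A₁

      v∉B : ¬ Bs j v
      v∉B = disj-A₁B j v v∈A₁

      attached : ∀ {A c x y} → WalkIn G A c x → Bs j y → Adj (G +E (u , v)) x y → Attached A c j
      attached w y∈B a =
        _ , _ , w , walk-+E-avoiding u∉B (walk-from-root j y∈B) , adj-+E-avoiding (Bs j) u∉B v∉B y∈B a

      attached₁ : EdgeBetween (G +E (u , v)) A₁ (Bs j) → Attached A₁ u j ⊎ Attached A₁ v j
      attached₁ (x , y , x∈A₁ , y∈B , a) =
        Sum.map (λ w → attached w y∈B a) (λ w → attached w y∈B a)
                (walk-+E-from-end (proj₂ conn-A₁ u x u∈A₁ x∈A₁))

      attached₂ : EdgeBetween (G +E (u , v)) A₂ (Bs j) → Attached A₂ a₂ j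
      attached₂ (x , y , x∈A₂ , y∈B , a) =
        attached (walk-+E-avoiding (disj-A₁A₂ u u∈A₁) (proj₂ conn-A₂ a₂ x a₂∈A₂ x∈A₂)) y∈B a

    model-if-edge-in-A₁ : RootedK2Model G R ⌈ t /2⌉
    model-if-edge-in-A₁ with select-half attached-to-an-end
    ... | inj₁ selection = restrict u∈A₁ a₂∈A₂ selection
    ... | inj₂ selection = restrict v∈A₁ a₂∈A₂ selection

  Occupied : Fin t → VSet n
  Occupied j w = A₁ w ⊎ A₂ w ⊎ Bs j w

  -- Deleting uv can detach B_j only if uv is its model edge or is needed inside B_j.
  UsesNewEdge : Fin t → Set
  UsesNewEdge j = (Bs j u × Occupied j v) ⊎ (Bs j v × Occupied j u)

  UsesNewEdge-unique : ∀ {j k} → UsesNewEdge j → UsesNewEdge k → j ≡ k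
  UsesNewEdge-unique {j} {k} Uj Uk with j ≟ k
  ... | yes j≡k = j≡k
  ... | no  j≢k = ⊥-elim (clash Uj Uk)
    where
    clash : UsesNewEdge j → UsesNewEdge k → ⊥
    clash (inj₁ (u∈Bj , _)) (inj₁ (u∈Bk , _)) = disj-BB j k j≢k u u∈Bj u∈Bk
    clash (inj₂ (v∈Bj , _)) (inj₂ (v∈Bk , _)) = disj-BB j k j≢k v v∈Bj v∈Bk
    clash (inj₁ (u∈Bj , _)) (inj₂ (_ , inj₁ u∈A₁))        = disj-A₁B j u u∈A₁ u∈Bj
    clash (inj₁ (u∈Bj , _)) (inj₂ (_ , inj₂ (inj₁ u∈A₂))) = disj-A₂B j u u∈A₂ u∈Bj
    clash (inj₁ (u∈Bj , _)) (inj₂ (_ , inj₂ (inj₂ u∈Bk))) = disj-BB j k j≢k u u∈Bj u∈Bk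
    clash (inj₂ (v∈Bj , _)) (inj₁ (_ , inj₁ v∈A₁))        = disj-A₁B j v v∈A₁ v∈Bj
    clash (inj₂ (v∈Bj , _)) (inj₁ (_ , inj₂ (inj₁ v∈A₂))) = disj-A₂B j v v∈A₂ v∈Bj
    clash (inj₂ (v∈Bj , _)) (inj₁ (_ , inj₂ (inj₂ v∈Bk))) = disj-BB j k j≢k v v∈Bj v∈Bk

  attached⊎usesNewEdge : ∀ {A c} j → (∀ {w} → A w → Occupied j w) →
                         (e : EdgeBetween (G +E (u , v)) A (Bs j)) → WalkIn G A c (proj₁ e) →
                         Attached A c j ⊎ UsesNewEdge j
  attached⊎usesNewEdge j A⊆ (x , y , x∈A , y∈B , inj₂ (inj₁ (refl , refl))) w = inj₂ (inj₂ (y∈B , A⊆ x∈A))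
  attached⊎usesNewEdge j A⊆ (x , y , x∈A , y∈B , inj₂ (inj₂ (refl , refl))) w = inj₂ (inj₁ (y∈B , A⊆ x∈A))
  attached⊎usesNewEdge j A⊆ (x , y , x∈A , y∈B , inj₁ g) w with walk-+E (walk-from-root j y∈B)
  ... | inj₁ w′                = inj₁ (x , y , w , w′ , g)
  ... | inj₂ (u∈B , v∈B , _)   = inj₂ (inj₁ (u∈B , inj₂ (inj₂ v∈B)))

  model-if-edges-reachable : (∀ j → WalkIn G A₁ a₁ (proj₁ (edge-A₁B j))) →
                             (∀ j → WalkIn G A₂ a₂ (proj₁ (edge-A₂B j))) →
                             t ≥ 2 → RootedK2Model G R ⌈ t /2⌉
  model-if-edges-reachable reach₁ reach₂ t≥2 =
    restrict a₁∈A₁ a₂∈A₂ (select-all-but-one classify UsesNewEdge-unique t≥2)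
    where
    classify : ∀ j → BothAttached a₁ a₂ j ⊎ UsesNewEdge j
    classify j with attached⊎usesNewEdge j inj₁ (edge-A₁B j) (reach₁ j)
                  | attached⊎usesNewEdge j (inj₂ ∘ inj₁) (edge-A₂B j) (reach₂ j)
    ... | inj₁ attached₁ | inj₁ attached₂ = inj₁ (attached₁ , attached₂)
    ... | inj₂ uses      | _              = inj₂ uses
    ... | inj₁ _         | inj₂ uses      = inj₂ uses

lemma5p12 : ∀ {n} (G : Graph n) (R : VSet n) (u v : Fin n) (t : ℕ) → t ≥ 2 →
    RootedK2Model (G +E (u , v)) R t → RootedK2Model G R ⌈ t /2⌉
lemma5p12 G R u v t t≥2 M with edge-in-A₁⊎edges-reachable M
... | inj₁ (u∈A₁ , v∈A₁) = model-if-edge-in-A₁ M u∈A₁ v∈A₁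
... | inj₂ reach₁ with edge-in-A₁⊎edges-reachable (swapSides M)
...   | inj₁ (u∈A₂ , v∈A₂) = swapSides (model-if-edge-in-A₁ (swapSides M) u∈A₂ v∈A₂)
...   | inj₂ reach₂        = model-if-edges-reachable M reach₁ reach₂ t≥2
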